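{- Let $n\ge 2$ and $c\ge 0$ be integers and $d=n+c$. Let $(A_0,A_1,\dots,A_n)$ be the $A$-partition of $cDB^+(n+c,n,n)$. Then for every $i$ with $2\le i\le n$ there exists a subset $S_i\subset A_i$ with $|S_i|=\frac{|A_i|}{c+1}=\frac{(n+c-1)!}{(c+1)!}$ such that every vertex of $A_{i-1}$ is dominated by some vertex of $S_i$.
   Context: Let $[d]=\{1,\dots,d\}$. A sequence $(x_1,\dots,x_n)\in[d]^n$ is $t$-constrained if for all $1\le i<j\le n$ with $x_i=x_j$ one has $j-i\ge t$; so $V(n+c,n,n)$ is the set of sequences of $n$ pairwise distinct symbols from $[n+c]$. The directed graph $cDB^+(d,t,n)$ has vertex set $V(d,t,n)$ (the $t$-constrained sequences in $[d]^n$) and an arc from $(a_1,\dots,a_n)$ to $(a_2,\dots,a_n,a_{n+1})$ whenever both lie in $V(d,t,n)$. In a directed graph a vertex dominates itself and its out-neighbours. The $A$-partition of $cDB^+(n+c,n,n)$ (with $d=n+c$) is $(A_0,\dots,A_n)$, where $A_0$ is the set of vertices not containing the symbol $d$ and, for $1\le i\le n$, $A_i$ is the set of vertices having symbol $d$ in position $i$; one has $|A_i|=\frac{(n+c-1)!}{c!}$ for $i\ge1$. -}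

module Defs where

open import Data.Nat using (ℕ; suc; _+_; _∸_; _≤_; _<_)
open import Data.Nat.Combinatorics using ()
open import Data.Nat.Base using (_!)
open import Data.Nat.DivMod using (_/_)
open import Data.Nat.Properties using (_!≢0)
open import Data.Fin using (Fin; toℕ)
open import Data.Vec using (Vec; lookup)
open import Data.Product using (_×_; Σ; ∃)
open import Data.Sum using (_⊎_)
open import Relation.Binary.PropositionalEquality using (_≡_)

-- Symbols of [d] = {1,…,d} are encoded as Fin d (symbol k ↦ element with toℕ = k - 1).
-- Positions 1,…,n are encoded as Fin n (position p ↦ element with toℕ = p - 1).
Seq : ℕ → ℕ → Set
Seq d n = Vec (Fin d) n

Constrained : ∀ {d n} → ℕ → Seq d n → Set
Constrained {d} {n} t x =
  ∀ (i j : Fin n) → toℕ i < toℕ j → lookup x i ≡ lookup x j → t ≤ toℕ j ∸ toℕ i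

V : (d t n : ℕ) → Seq d n → Set
V d t n x = Constrained t x

Arc : (d t n : ℕ) → Seq d n → Seq d n → Set
Arc d t n x y =
  V d t n x × V d t n y ×
  (∀ (i j : Fin n) → toℕ j ≡ suc (toℕ i) → lookup x j ≡ lookup y i)

Dominates : (d t n : ℕ) → Seq d n → Seq d n → Set
Dominates d t n u v = u ≡ v ⊎ Arc d t n u v

-- A_i (i ≥ 1) of cDB⁺(n+c,n,n): vertices with the symbol d = n+c in position i
-- (here the position is given as an element of Fin n, 0-based)
InA : (n c : ℕ) → Fin n → Seq (n + c) n → Set
InA n c i x = V (n + c) n n x × toℕ (lookup x i) ≡ n + c ∸ 1

sizeS : ℕ → ℕ → ℕ
sizeS n c = _/_ ((n + c ∸ 1) !) (suc c !) {{suc c !≢0}}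

-- Write m = n + c − 1 for the number of symbols other than d. A vertex v of A_{i−1} is an
-- arrangement of n distinct symbols with d in position i − 1; its first n − 1 entries consist
-- of d in position i − 1 and an arrangement xs of n − 2 symbols from [m]. The vertex
-- a ∷ (those n − 1 entries), with a ∈ [m] chosen outside xs, lies in A_i and has an arc to v.
-- Choosing one such a for every xs gives a set of size m!/(m − (n − 2))! = (n+c−1)!/(c+1)!
-- dominating A_{i−1}.
module Submission where

open import Defs
open import Data.Nat using (ℕ; zero; suc; _+_; _*_; _∸_; _≤_; _<_; s≤s)
open import Data.Nat.Base using (_!)
open import Data.Nat.DivMod using (_/_; m*n/n≡m)
open import Data.Nat.Properties
  using ( *-identityˡ; *-assoc; +-suc; m+n∸m≡n; m≤m+n; m≤n⇒m≤1+n; m∸n≤m; ≤-trans; ≤-<-trans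
        ; _!≢0)
  renaming (<-irrefl to <-irreflℕ; suc-injective to suc-injectiveℕ)
open import Data.Fin
  using (Fin; zero; suc; toℕ; fromℕ; inject₁; lower₁; punchIn; punchOut; _≟_)
open import Data.Fin.Properties
  using ( toℕ-injective; toℕ<n; toℕ-fromℕ; toℕ-inject₁; inject₁-injective; inject₁-lower₁
        ; fromℕ≢inject₁; punchIn-injective; punchInᵢ≢i; punchIn-punchOut; <-cmp; <-irrefl
        ; ¬∀⟶∃¬; pigeonhole)
open import Data.Vec using (Vec; []; _∷_; map; lookup; tabulate; insertAt; removeAt)
open import Data.Vec.Properties
  using ( ∷-injectiveˡ; ∷-injectiveʳ; lookup∘tabulate; tabulate∘lookup; insertAt-lookup
        ; removeAt-insertAt; insertAt-removeAt)
import Data.Vec.Relation.Unary.All as VecAll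
open VecAll using ([]; _∷_)
import Data.Vec.Relation.Unary.All.Properties as VecAllP
open import Data.Vec.Relation.Unary.AllPairs using ([]; _∷_)
import Data.Vec.Relation.Unary.Unique.Propositional as VecUnique
import Data.Vec.Relation.Unary.Unique.Propositional.Properties as VecUniqueP
open import Data.Vec.Relation.Unary.Any using (here; there; index)
open import Data.Vec.Relation.Unary.Any.Properties using (lookup-index)
import Data.Vec.Membership.Propositional as VecMem
import Data.Vec.Membership.DecPropositional as VecDecMem
open import Data.List as List using (List; []; _∷_; [_]; concat; length)
open import Data.List.Properties using (length-++; length-map)
open import Data.List.Relation.Unary.All using (All; []; _∷_)
import Data.List.Relation.Unary.All as ListAll
import Data.List.Relation.Unary.All.Properties as ListAllP
open import Data.List.Relation.Unary.Any using (Any; here)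
import Data.List.Relation.Unary.Any as ListAny
import Data.List.Relation.Unary.Any.Properties as ListAnyP
open import Data.List.Relation.Unary.AllPairs using ([]; _∷_)
import Data.List.Relation.Unary.AllPairs.Properties as ListAllPairsP
open import Data.List.Relation.Unary.Unique.Propositional using (Unique)
import Data.List.Relation.Unary.Unique.Propositional.Properties as UniqueP
open import Data.List.Membership.Propositional using (_∈_)
open import Data.Product using (Σ; ∃; _×_; _,_; proj₁; proj₂)
open import Data.Sum using (inj₂)
open import Function using (_∘_)
open import Relation.Binary.Definitions using (tri<; tri≈; tri>)
open import Relation.Binary.PropositionalEquality
  using (_≡_; _≢_; refl; sym; trans; cong; cong₂; subst; ≢-sym; module ≡-Reasoning)
open import Relation.Nullary using (¬_; contradiction)

private
  variable
    A B : Set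
    k m : ℕ

Distinct : Vec A k → Set
Distinct = VecUnique.Unique

map-injective : {f : A → B} → (∀ {x y} → f x ≡ f y → x ≡ y) →
                {xs ys : Vec A k} → map f xs ≡ map f ys → xs ≡ ys
map-injective f-inj {[]}     {[]}     _  = refl
map-injective f-inj {x ∷ xs} {y ∷ ys} eq =
  cong₂ _∷_ (f-inj (∷-injectiveˡ eq)) (map-injective f-inj (∷-injectiveʳ eq))

Distinct-map⁻ : {f : A → B} {xs : Vec A k} → Distinct (map f xs) → Distinct xs
Distinct-map⁻ {f = f} {xs = []}     []        = []
Distinct-map⁻ {f = f} {xs = x ∷ xs} (fx≢ ∷ u) =
  VecAll.map (λ ne → ne ∘ cong f) (VecAllP.map⁻ fx≢) ∷ Distinct-map⁻ u

Distinct-lookup⁻ : {xs : Vec A k} → (∀ i j → lookup xs i ≡ lookup xs j → i ≡ j) → Distinct xs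
Distinct-lookup⁻ {xs = xs} inj =
  subst Distinct (tabulate∘lookup xs) (VecUniqueP.tabulate⁺ (inj _ _))

preimages⇒map : {f : A → B} {ys : Vec B k} →
                VecAll.All (λ y → ∃ λ x → f x ≡ y) ys → ∃ λ xs → map f xs ≡ ys
preimages⇒map []               = [] , refl
preimages⇒map ((x , refl) ∷ ps) with preimages⇒map ps
... | xs , refl = x ∷ xs , refl

∉⇒All≢ : {x : A} {xs : Vec A k} → ¬ x VecMem.∈ xs → VecAll.All (x ≢_) xs
∉⇒All≢ {xs = []}     x∉ = []
∉⇒All≢ {xs = y ∷ xs} x∉ = (x∉ ∘ here) ∷ ∉⇒All≢ (x∉ ∘ there)

∃-fresh : k < m → (xs : Vec (Fin m) k) → ∃ λ y → VecAll.All (y ≢_) xs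
∃-fresh {m = m} k<m xs
  with ¬∀⟶∃¬ m (VecMem._∈ xs) (λ y → VecDecMem._∈?_ _≟_ y xs) covering-impossible
  where
  covering-impossible : ¬ (∀ y → y VecMem.∈ xs)
  covering-impossible all∈ with pigeonhole k<m (index ∘ all∈)
  ... | y , z , y<z , same-index = <-irrefl y≡z y<z
    where
    open ≡-Reasoning
    y≡z : y ≡ z
    y≡z = begin
      y                          ≡⟨ lookup-index (all∈ y) ⟩
      lookup xs (index (all∈ y)) ≡⟨ cong (lookup xs) same-index ⟩
      lookup xs (index (all∈ z)) ≡⟨ lookup-index (all∈ z) ⟨
      z                          ∎
... | y , y∉ = y , ∉⇒All≢ y∉

module _ {P : A → Set} {v : A} where

  All-insertAt⁺ : {xs : Vec A k} (i : Fin (suc k)) → P v → VecAll.All P xs →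
                  VecAll.All P (insertAt xs i v)
  All-insertAt⁺ zero                pv ps         = pv ∷ ps
  All-insertAt⁺ {xs = _ ∷ _} (suc i) pv (px ∷ ps) = px ∷ All-insertAt⁺ i pv ps

  All-insertAt⁻ : {xs : Vec A k} (i : Fin (suc k)) → VecAll.All P (insertAt xs i v) →
                  P v × VecAll.All P xs
  All-insertAt⁻ zero                (pv ∷ ps) = pv , ps
  All-insertAt⁻ {xs = _ ∷ _} (suc i) (px ∷ ps) with All-insertAt⁻ i ps
  ... | pv , pxs = pv , px ∷ pxs

module _ {v : A} where

  Distinct-insertAt⁺ : {xs : Vec A k} (i : Fin (suc k)) → VecAll.All (v ≢_) xs → Distinct xs →
                       Distinct (insertAt xs i v)
  Distinct-insertAt⁺ zero                v≢ u                 = v≢ ∷ u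
  Distinct-insertAt⁺ {xs = _ ∷ _} (suc i) (v≢x ∷ v≢) (x≢ ∷ u) =
    All-insertAt⁺ i (≢-sym v≢x) x≢ ∷ Distinct-insertAt⁺ i v≢ u

  Distinct-insertAt⁻ : {xs : Vec A k} (i : Fin (suc k)) → Distinct (insertAt xs i v) →
                       VecAll.All (v ≢_) xs × Distinct xs
  Distinct-insertAt⁻ zero                (v≢ ∷ u) = v≢ , u
  Distinct-insertAt⁻ {xs = _ ∷ _} (suc i) (x≢ ∷ u)
    with All-insertAt⁻ i x≢ | Distinct-insertAt⁻ i u
  ... | x≢v , x≢xs | v≢xs , u-xs = ≢-sym x≢v ∷ v≢xs , x≢xs ∷ u-xs

-- A gap j − i between two positions of a length-n sequence is below n, so n-constrained
-- sequences are exactly the repetition-free ones, and those are t-constrained for every t.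

Distinct⇒Constrained : ∀ {d n} t {x : Seq d n} → Distinct x → Constrained t x
Distinct⇒Constrained t u i j i<j eq =
  contradiction (VecUniqueP.lookup-injective u i j eq) (λ i≡j → <-irrefl i≡j i<j)

Constrained⇒Distinct : ∀ {d n} {x : Seq d n} → Constrained n x → Distinct x
Constrained⇒Distinct {n = n} {x} constrained = Distinct-lookup⁻ lookup-injective
  where
  gap-too-small : (i j : Fin n) → ¬ (n ≤ toℕ j ∸ toℕ i)
  gap-too-small i j n≤gap =
    <-irreflℕ refl (≤-<-trans (≤-trans n≤gap (m∸n≤m (toℕ j) (toℕ i))) (toℕ<n j))

  lookup-injective : ∀ i j → lookup x i ≡ lookup x j → i ≡ j
  lookup-injective i j eq with <-cmp i j
  ... | tri< i<j _ _ = contradiction (constrained i j i<j eq) (gap-too-small i j)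
  ... | tri≈ _ i≡j _ = i≡j
  ... | tri> _ _ j<i = contradiction (constrained j i j<i (sym eq)) (gap-too-small j i)

dropLast : Vec A (suc k) → Vec A k
dropLast v = tabulate (lookup v ∘ inject₁)

Arc-∷-dropLast : ∀ {d t n} {a : Fin d} {xs : Vec (Fin d) n} {y : Seq d (suc n)} →
                 V d t (suc n) (a ∷ xs) → V d t (suc n) y → xs ≡ dropLast y →
                 Arc d t (suc n) (a ∷ xs) y
Arc-∷-dropLast {y = y} vx vy refl = vx , vy , shifted
  where
  shifted : ∀ i j → toℕ j ≡ suc (toℕ i) → lookup (_ ∷ dropLast y) j ≡ lookup y i
  shifted i (suc j) j≡i+1 = trans (lookup∘tabulate (lookup y ∘ inject₁) j)
    (cong (lookup y) (toℕ-injective (trans (toℕ-inject₁ j) (suc-injectiveℕ j≡i+1))))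

extend : Fin (suc m) → Vec (Fin m) k → Vec (Fin (suc m)) (suc k)
extend x ys = x ∷ map (punchIn x) ys

arrangements : (m k : ℕ) → List (Vec (Fin m) k)
extensions : (m k : ℕ) → Fin (suc m) → List (Vec (Fin (suc m)) (suc k))

arrangements m       zero    = [ [] ]
arrangements zero    (suc k) = []
arrangements (suc m) (suc k) = concat (List.tabulate (extensions m k))

extensions m k x = List.map (extend x) (arrangements m k)

arrangements-distinct : ∀ m k → All Distinct (arrangements m k)
arrangements-distinct m       zero    = [] ∷ []
arrangements-distinct zero    (suc k) = []
arrangements-distinct (suc m) (suc k) = ListAllP.concat⁺
  (ListAllP.tabulate⁺ {f = extensions m k} λ x →
    ListAllP.map⁺ (ListAll.map (extend-distinct x) (arrangements-distinct m k)))
  where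
  extend-distinct : ∀ x {ys} → Distinct ys → Distinct (extend x ys)
  extend-distinct x u =
    VecAllP.map⁺ (VecAll.universal (λ y → ≢-sym (punchInᵢ≢i x y)) _) ∷
    VecUniqueP.map⁺ (punchIn-injective x _ _) u

arrangements-unique : ∀ m k → Unique (arrangements m k)
arrangements-unique m       zero    = [] ∷ []
arrangements-unique zero    (suc k) = []
arrangements-unique (suc m) (suc k) = ListAllPairsP.concat⁺
  (ListAllP.tabulate⁺ λ x → UniqueP.map⁺ (extend-injective x) (arrangements-unique m k))
  (ListAllPairsP.tabulate⁺ {f = extensions m k} λ x≢y →
    ListAllP.map⁺ (ListAll.universal (λ _ →
      ListAllP.map⁺ (ListAll.universal (λ _ eq → x≢y (∷-injectiveˡ eq)) _)) _))
  where
  extend-injective : ∀ x {ys zs} → extend x ys ≡ extend x zs → ys ≡ zs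
  extend-injective x eq = map-injective (punchIn-injective x _ _) (∷-injectiveʳ eq)

arrangements-complete : {xs : Vec (Fin m) k} → Distinct xs → xs ∈ arrangements m k
arrangements-complete {m = m}     {xs = []}     _ = here refl
arrangements-complete {m = suc m} {k = suc k} {xs = x ∷ zs} (x≢ ∷ u)
  with preimages⇒map (VecAll.map (λ x≢z → punchOut x≢z , punchIn-punchOut x≢z) x≢)
... | ws , refl = ListAnyP.concat⁺ (ListAnyP.tabulate⁺ {f = extensions m k} x
  (ListAnyP.map⁺ (ListAny.map (cong (extend x)) (arrangements-complete (Distinct-map⁻ u)))))

length-concat-tabulate : ∀ {n l} (f : Fin n → List A) → (∀ i → length (f i) ≡ l) →
                         length (concat (List.tabulate f)) ≡ n * l
length-concat-tabulate {n = zero}  f same = refl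
length-concat-tabulate {n = suc n} f same = trans (length-++ (f zero))
  (cong₂ _+_ (same zero) (length-concat-tabulate (f ∘ suc) (same ∘ suc)))

length-arrangements : k ≤ m → length (arrangements m k) * (m ∸ k) ! ≡ m !
length-arrangements {zero}              _         = *-identityˡ _
length-arrangements {suc k} {m = suc m} (s≤s k≤m) = begin
  length (concat (List.tabulate (extensions m k))) * (m ∸ k) !
    ≡⟨ cong (_* (m ∸ k) !) (length-concat-tabulate (extensions m k)
                              (λ x → length-map (extend x) (arrangements m k))) ⟩
  suc m * length (arrangements m k) * (m ∸ k) !
    ≡⟨ *-assoc (suc m) (length (arrangements m k)) ((m ∸ k) !) ⟩
  suc m * (length (arrangements m k) * (m ∸ k) !)
    ≡⟨ cong (suc m *_) (length-arrangements k≤m) ⟩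
  suc m !
    ∎
  where open ≡-Reasoning

-- Here n = n′ + 2, the n + c symbols are Fin (suc m′) with top playing the role of d, and
-- i₀ is the 0-based index of position i − 1 (so position i is suc i₀).

module DominatingSet (n′ c : ℕ) (i₀ : Fin (suc n′)) where

  m′ : ℕ
  m′ = suc (n′ + c)

  top : Fin (suc m′)
  top = fromℕ m′

  fresh : Vec (Fin m′) n′ → Fin m′
  fresh xs = proj₁ (∃-fresh (s≤s (m≤m+n n′ c)) xs)

  fresh-∉ : (xs : Vec (Fin m′) n′) → VecAll.All (fresh xs ≢_) xs
  fresh-∉ xs = proj₂ (∃-fresh (s≤s (m≤m+n n′ c)) xs)

  dominator : Vec (Fin m′) n′ → Seq (suc (suc n′) + c) (suc (suc n′))
  dominator xs = inject₁ (fresh xs) ∷ insertAt (map inject₁ xs) i₀ top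

  dominator-injective : {xs ys : Vec (Fin m′) n′} → dominator xs ≡ dominator ys → xs ≡ ys
  dominator-injective {xs} {ys} eq = map-injective inject₁-injective (begin
    map inject₁ xs
      ≡⟨ removeAt-insertAt _ i₀ top ⟨
    removeAt (insertAt (map inject₁ xs) i₀ top) i₀
      ≡⟨ cong (λ t → removeAt t i₀) (∷-injectiveʳ eq) ⟩
    removeAt (insertAt (map inject₁ ys) i₀ top) i₀
      ≡⟨ removeAt-insertAt _ i₀ top ⟩
    map inject₁ ys ∎)
    where open ≡-Reasoning

  dominator-distinct : {xs : Vec (Fin m′) n′} → Distinct xs → Distinct (dominator xs)
  dominator-distinct {xs} u = head-fresh ∷ tail-distinct
    where
    head-fresh : VecAll.All (inject₁ (fresh xs) ≢_) (insertAt (map inject₁ xs) i₀ top)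
    head-fresh = All-insertAt⁺ i₀ (≢-sym fromℕ≢inject₁)
      (VecAllP.map⁺ (VecAll.map (λ ne → ne ∘ inject₁-injective) (fresh-∉ xs)))

    tail-distinct : Distinct (insertAt (map inject₁ xs) i₀ top)
    tail-distinct = Distinct-insertAt⁺ i₀
      (VecAllP.map⁺ (VecAll.universal (λ _ → fromℕ≢inject₁) _))
      (VecUniqueP.map⁺ inject₁-injective u)

  dominator-∈A : {xs : Vec (Fin m′) n′} → Distinct xs →
                 InA (suc (suc n′)) c (suc i₀) (dominator xs)
  dominator-∈A u = Distinct⇒Constrained _ (dominator-distinct u)
                 , trans (cong toℕ (insertAt-lookup _ i₀ top)) (toℕ-fromℕ m′)

  dominator-dominates : ∀ {v} → InA (suc (suc n′)) c (inject₁ i₀) v →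
    ∃ λ xs → Distinct xs × Arc (suc (suc n′) + c) (suc (suc n′)) (suc (suc n′)) (dominator xs) v
  dominator-dominates {v} (v-constrained , v[i₀]≡d) =
    xs , xs-distinct ,
    Arc-∷-dropLast {y = v} (Distinct⇒Constrained _ (dominator-distinct xs-distinct))
                           v-constrained tail≡w
    where
    open ≡-Reasoning
    w : Vec (Fin (suc m′)) (suc n′)
    w = dropLast v

    r : Vec (Fin (suc m′)) n′
    r = removeAt w i₀

    w[i₀]≡top : lookup w i₀ ≡ top
    w[i₀]≡top = trans (lookup∘tabulate (lookup v ∘ inject₁) i₀)
                      (toℕ-injective (trans v[i₀]≡d (sym (toℕ-fromℕ m′))))

    w-distinct : Distinct w
    w-distinct = VecUniqueP.tabulate⁺ {f = lookup v ∘ inject₁} (inject₁-injective ∘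
      VecUniqueP.lookup-injective (Constrained⇒Distinct {x = v} v-constrained) _ _)

    r-split : VecAll.All (lookup w i₀ ≢_) r × Distinct r
    r-split = Distinct-insertAt⁻ i₀ (subst Distinct (sym (insertAt-removeAt w i₀)) w-distinct)

    lowerable : ∀ {z} → lookup w i₀ ≢ z → ∃ λ y → inject₁ y ≡ z
    lowerable {z} ne = lower₁ z m′≢z , inject₁-lower₁ z m′≢z
      where
      m′≢z : m′ ≢ toℕ z
      m′≢z e = ne (trans w[i₀]≡top (toℕ-injective (trans (toℕ-fromℕ m′) e)))

    lowered : ∃ λ xs → map inject₁ xs ≡ r
    lowered = preimages⇒map (VecAll.map lowerable (proj₁ r-split))

    xs : Vec (Fin m′) n′
    xs = proj₁ lowered

    xs-distinct : Distinct xs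
    xs-distinct = Distinct-map⁻ (subst Distinct (sym (proj₂ lowered)) (proj₂ r-split))

    tail≡w : insertAt (map inject₁ xs) i₀ top ≡ w
    tail≡w = begin
      insertAt (map inject₁ xs) i₀ top
        ≡⟨ cong₂ (λ t e → insertAt t i₀ e) (proj₂ lowered) (sym w[i₀]≡top) ⟩
      insertAt r i₀ (lookup w i₀)
        ≡⟨ insertAt-removeAt w i₀ ⟩
      w ∎

  length-dominatingSet :
    length (List.map dominator (arrangements m′ n′)) ≡ sizeS (suc (suc n′)) c
  length-dominatingSet = begin
    length (List.map dominator (arrangements m′ n′))
      ≡⟨ length-map dominator (arrangements m′ n′) ⟩
    length (arrangements m′ n′)
      ≡⟨ m*n/n≡m _ (suc c !) ⟨
    length (arrangements m′ n′) * suc c ! / suc c !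
      ≡⟨ cong (λ r → length (arrangements m′ n′) * r ! / suc c !) m′∸n′≡1+c ⟨
    length (arrangements m′ n′) * (m′ ∸ n′) ! / suc c !
      ≡⟨ cong (_/ suc c !) (length-arrangements (m≤n⇒m≤1+n (m≤m+n n′ c))) ⟩
    m′ ! / suc c ! ∎
    where
    open ≡-Reasoning
    instance _ = suc c !≢0
    m′∸n′≡1+c : m′ ∸ n′ ≡ suc c
    m′∸n′≡1+c = trans (cong (_∸ n′) (sym (+-suc n′ c))) (m+n∸m≡n n′ (suc c))

lemma1 : (n c : ℕ) → 2 ≤ n →
    (i j : Fin n) → toℕ i ≡ suc (toℕ j) →
    Σ (List (Seq (n + c) n)) λ S →
    Unique S × All (InA n c i) S × length S ≡ sizeS n c ×
    ((v : Seq (n + c) n) → InA n c j v →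
    Any (λ s → Dominates (n + c) n n s v) S)
-- The hypothesis 2 ≤ n is unused: it already follows from toℕ i ≡ suc (toℕ j).
lemma1 (suc (suc n′)) c _ zero    j ()
lemma1 (suc (suc n′)) c _ (suc i₀) j i≡j+1
  with toℕ-injective {i = inject₁ i₀} {j = j}
         (trans (toℕ-inject₁ i₀) (suc-injectiveℕ i≡j+1))
... | refl =
  List.map dominator (arrangements m′ n′) ,
  UniqueP.map⁺ dominator-injective (arrangements-unique m′ n′) ,
  ListAllP.map⁺ (ListAll.map dominator-∈A (arrangements-distinct m′ n′)) ,
  length-dominatingSet ,
  λ v v∈A → let xs , xs-distinct , arc = dominator-dominates {v} v∈A in
    ListAnyP.map⁺ (ListAny.map (λ { refl → inj₂ arc }) (arrangements-complete xs-distinct))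
  where open DominatingSet n′ c i₀
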